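{- Let $V$ be a vector configuration and $W\subseteq V$ a subconfiguration such that $\operatorname{lin}(W)\cap V=W$ (every element of $V$ lying in $\operatorname{lin}(W)$ belongs to $W$). Then $\operatorname{Disc}(V)\ge\operatorname{Disc}(W)+\operatorname{Disc}(V/W)$.
   Context: A vector configuration is a finite family of vectors in $\mathbb{R}^r$ (repetitions and zero vectors allowed); subconfigurations are subfamilies; cardinalities count multiplicities. For $W\subseteq V$, $V/W$ is the family of images of the elements of $V\setminus W$ in the quotient space $\mathbb{R}^r/\operatorname{lin}(W)$. For an oriented linear hyperplane $H$ (of the relevant ambient space) given by a nonzero linear functional $f$, $H^+=\{f>0\}$, $H^-=\{f<0\}$; $\operatorname{Disc}(U)=\max_H(|H^+\cap U|-|H^-\cap U|)$ over all oriented linear hyperplanes. -}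

module Defs where

open import Level using (0ℓ)
open import Data.Nat using (ℕ; zero; suc)
import Data.Nat
import Data.Fin
import Data.Unit
import Data.Integer
import Data.Fin.Subset
open import Data.Integer using (ℤ; +_; _-_)
open import Data.Fin using (Fin)
open import Data.Bool using (Bool; true; false; _∧_; if_then_else_)
open import Data.Vec using (lookup)
open import Data.Fin.Subset using (Subset)
open import Data.Product using (Σ; ∃; _×_)
open import Data.Sum using (_⊎_)
open import Relation.Nullary using (¬_)
open import Relation.Nullary.Decidable using (isYes)
open import Relation.Binary.PropositionalEquality using (_≡_)
open import Algebra.Structures using (IsCommutativeRing)
open import Relation.Binary.Structures using (IsStrictTotalOrder)

-- The real numbers, axiomatised as a (Dedekind-)complete ordered field
-- with propositional equality and a decidable (trichotomous) order.
-- Any two models are isomorphic, so quantifying over all models is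
-- stating the result for ℝ.

record RealField : Set₁ where
  infixl 6 _+_
  infixl 7 _*_
  infix  4 _<_ _≤_
  field
    Carrier : Set
    _+_ _*_ : Carrier → Carrier → Carrier
    -_      : Carrier → Carrier
    0# 1#   : Carrier
    _<_     : Carrier → Carrier → Set
    isCommutativeRing : IsCommutativeRing _≡_ _+_ _*_ -_ 0# 1#
    isStrictTotalOrder : IsStrictTotalOrder _≡_ _<_
    0≢1     : ¬ (0# ≡ 1#)
    inverse : ∀ x → ¬ (x ≡ 0#) → ∃ λ y → x * y ≡ 1#
    +-mono-< : ∀ {x y} z → x < y → x + z < y + z
    *-pos   : ∀ {x y} → 0# < x → 0# < y → 0# < x * y

  _≤_ : Carrier → Carrier → Set
  x ≤ y = x < y ⊎ x ≡ y

  field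
    complete : (P : Carrier → Set) → (∃ λ x → P x) →
               (∃ λ b → ∀ x → P x → x ≤ b) →
               ∃ λ s → (∀ x → P x → x ≤ s) ×
                       (∀ b → (∀ x → P x → x ≤ b) → s ≤ b)

  open IsStrictTotalOrder isStrictTotalOrder public using (_<?_)

module LinAlg (R : RealField) where
  open RealField R

  Vector : ℕ → Set
  Vector r = Fin r → Carrier

  ∑ : ∀ {n} → (Fin n → Carrier) → Carrier
  ∑ {zero}  f = 0#
  ∑ {suc n} f = f Data.Fin.zero + ∑ (λ i → f (Data.Fin.suc i))


  ev : ∀ {r} → Vector r → Vector r → Carrier
  ev a v = ∑ (λ j → a j * v j)

  -- v ∈ lin(W), where W is the subfamily of V : Fin n → Vector r
  -- indexed by the mask S
  InLin : ∀ {r n} → (V : Fin n → Vector r) → Subset n → Vector r → Set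
  InLin {n = n} V S v =
    ∃ λ (c : Fin n → Carrier) →
      ∀ j → v j ≡ ∑ (λ i → if lookup S i then c i * V i j else 0#)

  count : ∀ {n} → (Fin n → Bool) → ℕ
  count {zero}  b = 0
  count {suc n} b = (if b Data.Fin.zero then 1 else 0) Data.Nat.+ count (λ i → b (Data.Fin.suc i))

  score : ∀ {r n} → (V : Fin n → Vector r) → Subset n → Vector r → ℤ
  score V M a =
    + count (λ i → lookup M i ∧ isYes (0# <? ev a (V i)))
    - + count (λ i → lookup M i ∧ isYes (ev a (V i) <? 0#))

  IsMaxOver : ∀ {r} → (Vector r → Set) → (Vector r → ℤ) → ℤ → Set
  IsMaxOver A s d = (∃ λ a → A a × s a ≡ d) × (∀ a → A a → s a Data.Integer.≤ d)

  IsDisc : ∀ {r n} → (V : Fin n → Vector r) → Subset n → ℤ → Set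
  IsDisc V M d = IsMaxOver (λ _ → Data.Unit.⊤) (score V M) d

  -- Disc(V/W), W indexed by S: linear functionals on ℝ^r / lin(W) are
  -- exactly the functionals on ℝ^r vanishing on W; V/W consists of the
  -- images of the elements of V outside W.
  IsDiscQuot : ∀ {r n} → (V : Fin n → Vector r) → Subset n → ℤ → Set
  IsDiscQuot V S d =
    IsMaxOver (λ a → ∀ i → lookup S i ≡ true → ev a (V i) ≡ 0#)
              (score V (Data.Fin.Subset.∁ S)) d

-- Let a vanish on W and attain Disc(V/W), and let b attain Disc(W). Since lin(W) ∩ V = W, every
-- v ∈ V ∖ W is separated from lin(W) by a functional h vanishing on W. For small ε > 0 the
-- functionals a ± ε h keep the sign of a wherever a is nonzero and have opposite signs on the zeros
-- of a, so one of them scores at least as well on V ∖ W while becoming nonzero at v. Repeating this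
-- makes a nonzero on all of V ∖ W; then for small δ > 0 the functional a + δ b has the sign of b on W
-- and the sign of a off W, so its score on V is Disc(W) + Disc(V/W).
module Submission where

open import Level using (0ℓ)
open import Data.Bool as Bool using (Bool; true; false; _∧_; if_then_else_; not)
open import Data.Empty using (⊥-elim)
open import Function using (case_of_; _∘_)
open import Data.Fin using (Fin; zero; suc)
open import Data.Fin.Subset using (Subset; ⊤; ∁)
open import Data.Vec using (lookup; _∷_; [])
open import Data.Vec.Properties using (lookup-replicate; lookup-map)
open import Data.Integer as ℤ using (ℤ; 0ℤ; 1ℤ; -1ℤ)
import Data.Integer.Properties as ℤ
open import Data.Fin.Properties using (all?; ¬∀⟶∃¬)
open import Data.Nat as ℕ using (ℕ; zero; suc)
open import Data.List using (List; []; _∷_; allFin)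
open import Data.List.Membership.Propositional.Properties using (∈-allFin)
open import Data.List.Relation.Unary.All as All using (All; []; _∷_)
open import Data.Product using (∃; _×_; _,_)
open import Data.Sum using (_⊎_; inj₁; inj₂)
open import Data.Integer.Tactic.RingSolver using (solve-∀)
open import Relation.Binary.Definitions using (tri<; tri≈; tri>)
open import Relation.Binary.PropositionalEquality
open import Relation.Nullary using (¬_; Dec; yes; no; contradiction)
open import Relation.Nullary.Decidable using (isYes; isYes≗does; dec-true; dec-false)
open import Algebra.Bundles using (CommutativeRing)
open import Relation.Binary.Structures using (IsStrictTotalOrder)

open import Defs

module RealFieldProperties (R : RealField) where
  open RealField R

  commutativeRing : CommutativeRing 0ℓ 0ℓ
  commutativeRing = record { isCommutativeRing = isCommutativeRing }

  open CommutativeRing commutativeRing public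
    using (ring; semiring; commutativeSemiring; +-assoc; +-identityˡ; +-identityʳ;
           *-identityˡ; *-identityʳ; zeroˡ; zeroʳ; distribʳ; -‿inverseʳ)
  open import Algebra.Properties.Ring ring public
    using (-‿distribˡ-*; -‿distribʳ-*; -‿involutive; -0#≈0#; -‿+-comm)
  open import Algebra.Solver.Ring.NaturalCoefficients.Default commutativeSemiring public
    using (solve; _:+_; _:*_; _:=_)
  open IsStrictTotalOrder isStrictTotalOrder using (compare; irrefl; _≟_) renaming (trans to <-trans; asym to <-asym)

  open ≡-Reasoning

  -x*y≡x*-y : ∀ x y → (- x) * y ≡ x * (- y)
  -x*y≡x*-y x y = trans (sym (-‿distribˡ-* x y)) (-‿distribʳ-* x y)

  *-≢0 : ∀ {x y} → ¬ x ≡ 0# → ¬ y ≡ 0# → ¬ x * y ≡ 0#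
  *-≢0 {x} {y} x≢0 y≢0 xy≡0 with inverse x x≢0
  ... | x⁻¹ , xx⁻¹≡1 = y≢0 (begin
    y                ≡⟨ sym (*-identityˡ y) ⟩
    1# * y           ≡⟨ cong (_* y) (sym xx⁻¹≡1) ⟩
    (x * x⁻¹) * y    ≡⟨ solve 3 (λ x x⁻¹ y → (x :* x⁻¹) :* y := x⁻¹ :* (x :* y)) refl x x⁻¹ y ⟩
    x⁻¹ * (x * y)    ≡⟨ cong (x⁻¹ *_) xy≡0 ⟩
    x⁻¹ * 0#         ≡⟨ zeroʳ x⁻¹ ⟩
    0#               ∎)

  t*z+[x+-t*z]≡x : ∀ x t z → t * z + (x + (- t) * z) ≡ x
  t*z+[x+-t*z]≡x x t z = begin
    t * z + (x + (- t) * z)     ≡⟨ cong (λ w → t * z + (x + w)) (sym (-‿distribˡ-* t z)) ⟩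
    t * z + (x + - (t * z))     ≡⟨ solve 3 (λ a x b → a :+ (x :+ b) := x :+ (a :+ b)) refl (t * z) x (- (t * z)) ⟩
    x + (t * z + - (t * z))     ≡⟨ cong (x +_) (-‿inverseʳ (t * z)) ⟩
    x + 0#                      ≡⟨ +-identityʳ x ⟩
    x                           ∎

  x+-[xc]*q≡0 : ∀ {q c} x → q * c ≡ 1# → x + (- (x * c)) * q ≡ 0#
  x+-[xc]*q≡0 {q} {c} x qc≡1 = begin
    x + (- (x * c)) * q   ≡⟨ cong (x +_) (sym (-‿distribˡ-* (x * c) q)) ⟩
    x + - ((x * c) * q)   ≡⟨ cong (λ w → x + - w) (solve 3 (λ x c q → (x :* c) :* q := x :* (q :* c)) refl x c q) ⟩
    x + - (x * (q * c))   ≡⟨ cong (λ w → x + - (x * w)) qc≡1 ⟩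
    x + - (x * 1#)        ≡⟨ cong (λ w → x + - w) (*-identityʳ x) ⟩
    x + - x               ≡⟨ -‿inverseʳ x ⟩
    0#                    ∎

  -[xc]*y≡-[yc]*x : ∀ x c y → (- (x * c)) * y ≡ (- (y * c)) * x
  -[xc]*y≡-[yc]*x x c y = begin
    (- (x * c)) * y   ≡⟨ sym (-‿distribˡ-* (x * c) y) ⟩
    - ((x * c) * y)   ≡⟨ cong -_ (solve 3 (λ x c y → (x :* c) :* y := (y :* c) :* x) refl x c y) ⟩
    - ((y * c) * x)   ≡⟨ -‿distribˡ-* (y * c) x ⟩
    (- (y * c)) * x   ∎

  0<x⇒-x<0 : ∀ {x} → 0# < x → - x < 0#
  0<x⇒-x<0 {x} 0<x = subst₂ _<_ (+-identityˡ (- x)) (-‿inverseʳ x) (+-mono-< (- x) 0<x)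

  x<0⇒0<-x : ∀ {x} → x < 0# → 0# < - x
  x<0⇒0<-x {x} x<0 = subst₂ _<_ (-‿inverseʳ x) (+-identityˡ (- x)) (+-mono-< (- x) x<0)

  <⇒0<-diff : ∀ {x y} → x < y → 0# < y + - x
  <⇒0<-diff {x} {y} x<y = subst (_< y + - x) (-‿inverseʳ x) (+-mono-< (- x) x<y)

  0<x⇒x≢0 : ∀ {x} → 0# < x → ¬ x ≡ 0#
  0<x⇒x≢0 0<x x≡0 = irrefl (sym x≡0) 0<x

  x<0⇒x≢0 : ∀ {x} → x < 0# → ¬ x ≡ 0#
  x<0⇒x≢0 x<0 x≡0 = irrefl x≡0 x<0

  ≤-<-trans : ∀ {x y z} → x ≤ y → y < z → x < z
  ≤-<-trans (inj₁ x<y) y<z = <-trans x<y y<z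
  ≤-<-trans (inj₂ refl) y<z = y<z

  0<1 : 0# < 1#
  0<1 with compare 0# 1#
  ... | tri< 0<1 _ _ = 0<1
  ... | tri≈ _ 0≡1 _ = ⊥-elim (0≢1 0≡1)
  ... | tri> _ _ 1<0 = ⊥-elim (<-asym 1<0 (subst (0# <_) -1*-1≡1 (*-pos 0<-1 0<-1)))
    where
    0<-1 : 0# < - 1#
    0<-1 = x<0⇒0<-x 1<0
    -1*-1≡1 : (- 1#) * (- 1#) ≡ 1#
    -1*-1≡1 = trans (sym (-‿distribˡ-* 1# (- 1#))) (trans (cong -_ (*-identityˡ (- 1#))) (-‿involutive 1#))

  +-pos : ∀ {x y} → 0# < x → 0# ≤ y → 0# < x + y
  +-pos {x} {y} 0<x (inj₁ 0<y) = <-trans 0<y (subst (_< x + y) (+-identityˡ y) (+-mono-< y 0<x))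
  +-pos {x} 0<x (inj₂ refl) = subst (0# <_) (sym (+-identityʳ x)) 0<x

  *-pos-neg : ∀ {x y} → 0# < x → y < 0# → x * y < 0#
  *-pos-neg {x} {y} 0<x y<0 =
    subst (_< 0#) (-‿involutive (x * y))
      (0<x⇒-x<0 (subst (0# <_) (sym (-‿distribʳ-* x y)) (*-pos 0<x (x<0⇒0<-x y<0))))

  inverse-pos : ∀ {x y} → 0# < x → x * y ≡ 1# → 0# < y
  inverse-pos {x} {y} 0<x xy≡1 with compare y 0#
  ... | tri< y<0 _ _ = ⊥-elim (<-asym 0<1 (subst (_< 0#) xy≡1 (*-pos-neg 0<x y<0)))
  ... | tri≈ _ y≡0 _ = ⊥-elim (0≢1 (trans (sym (zeroʳ x)) (trans (cong (x *_) (sym y≡0)) xy≡1)))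
  ... | tri> _ _ 0<y = 0<y

  bit : Bool → ℕ
  bit b = if b then 1 else 0

  sgn : Carrier → ℤ
  sgn x = ℤ.+ bit (isYes (0# <? x)) ℤ.- ℤ.+ bit (isYes (x <? 0#))

  private
    sgn-by : ∀ {x p n} → isYes (0# <? x) ≡ p → isYes (x <? 0#) ≡ n → sgn x ≡ ℤ.+ bit p ℤ.- ℤ.+ bit n
    sgn-by p≡ n≡ = cong₂ (λ p n → ℤ.+ bit p ℤ.- ℤ.+ bit n) p≡ n≡

    isYes-true : ∀ {A : Set} (a? : Dec A) → A → isYes a? ≡ true
    isYes-true a? a = trans (isYes≗does a?) (dec-true a? a)

    isYes-false : ∀ {A : Set} (a? : Dec A) → ¬ A → isYes a? ≡ false
    isYes-false a? ¬a = trans (isYes≗does a?) (dec-false a? ¬a)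

  sgn-pos : ∀ {x} → 0# < x → sgn x ≡ 1ℤ
  sgn-pos 0<x = sgn-by (isYes-true _ 0<x) (isYes-false _ (<-asym 0<x))

  sgn-neg : ∀ {x} → x < 0# → sgn x ≡ -1ℤ
  sgn-neg x<0 = sgn-by (isYes-false _ (<-asym x<0)) (isYes-true _ x<0)

  sgn-0 : sgn 0# ≡ 0ℤ
  sgn-0 = sgn-by (isYes-false _ (irrefl refl)) (isYes-false _ (irrefl refl))

  sgn≡0⇒≡0 : ∀ {x} → sgn x ≡ 0ℤ → x ≡ 0#
  sgn≡0⇒≡0 {x} sgn≡0 = case compare x 0# of λ where
    (tri< x<0 _ _) → case trans (sym (sgn-neg x<0)) sgn≡0 of λ ()
    (tri≈ _ x≡0 _) → x≡0
    (tri> _ _ 0<x) → case trans (sym (sgn-pos 0<x)) sgn≡0 of λ ()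

  sgn-≡⇒≢0 : ∀ {x y} → sgn x ≡ sgn y → ¬ y ≡ 0# → ¬ x ≡ 0#
  sgn-≡⇒≢0 sgnx≡sgny y≢0 refl = y≢0 (sgn≡0⇒≡0 (trans (sym sgnx≡sgny) sgn-0))

  sgn-‿ : ∀ x → sgn (- x) ≡ ℤ.- sgn x
  sgn-‿ x = case compare x 0# of λ where
    (tri< x<0 _ _) → trans (sgn-pos (x<0⇒0<-x x<0)) (cong ℤ.-_ (sym (sgn-neg x<0)))
    (tri≈ _ refl _) → trans (cong sgn -0#≈0#) (trans sgn-0 (cong ℤ.-_ (sym sgn-0)))
    (tri> _ _ 0<x) → trans (sgn-neg (0<x⇒-x<0 0<x)) (cong ℤ.-_ (sym (sgn-pos 0<x)))

  sgn-*-pos : ∀ {t} y → 0# < t → sgn (t * y) ≡ sgn y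
  sgn-*-pos {t} y 0<t = case compare y 0# of λ where
    (tri< y<0 _ _) → trans (sgn-neg (*-pos-neg 0<t y<0)) (sym (sgn-neg y<0))
    (tri≈ _ refl _) → cong sgn (zeroʳ t)
    (tri> _ _ 0<y) → trans (sgn-pos (*-pos 0<t 0<y)) (sym (sgn-pos 0<y))

  Eventually : (Carrier → Set) → Set
  Eventually P = ∃ λ ε → 0# < ε × ∀ δ → 0# < δ → δ ≤ ε → P δ

  eventually-always : ∀ {P} → (∀ δ → P δ) → Eventually P
  eventually-always P-all = 1# , 0<1 , λ δ _ _ → P-all δ

  eventually-map : ∀ {P Q : Carrier → Set} → (∀ {δ} → P δ → Q δ) → Eventually P → Eventually Q
  eventually-map P⇒Q (ε , 0<ε , P-small) = ε , 0<ε , λ δ 0<δ δ≤ε → P⇒Q (P-small δ 0<δ δ≤ε)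

  eventually-× : ∀ {P Q} → Eventually P → Eventually Q → Eventually (λ δ → P δ × Q δ)
  eventually-× (ε₁ , 0<ε₁ , P-small) (ε₂ , 0<ε₂ , Q-small) with compare ε₁ ε₂
  ... | tri< ε₁<ε₂ _ _ = ε₁ , 0<ε₁ , λ δ 0<δ δ≤ε₁ →
          P-small δ 0<δ δ≤ε₁ , Q-small δ 0<δ (inj₁ (≤-<-trans δ≤ε₁ ε₁<ε₂))
  ... | tri≈ _ refl _ = ε₁ , 0<ε₁ , λ δ 0<δ δ≤ε₁ → P-small δ 0<δ δ≤ε₁ , Q-small δ 0<δ δ≤ε₁
  ... | tri> _ _ ε₂<ε₁ = ε₂ , 0<ε₂ , λ δ 0<δ δ≤ε₂ →
          P-small δ 0<δ (inj₁ (≤-<-trans δ≤ε₂ ε₂<ε₁)) , Q-small δ 0<δ δ≤ε₂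

  eventually-∀ : ∀ {n} {P : Fin n → Carrier → Set} → (∀ i → Eventually (P i)) →
                 Eventually (λ δ → ∀ i → P i δ)
  eventually-∀ {zero} _ = eventually-always λ _ ()
  eventually-∀ {suc n} P-small =
    eventually-map (λ { (P₀ , P₊) → λ { zero → P₀ ; (suc i) → P₊ i } })
      (eventually-× (P-small zero) (eventually-∀ (P-small ∘ suc)))

  eventually⇒∃ : ∀ {P} → Eventually P → ∃ λ δ → 0# < δ × P δ
  eventually⇒∃ (ε , 0<ε , P-small) = ε , 0<ε , P-small ε 0<ε (inj₂ refl)

  eventually-pos : ∀ {x} y → 0# < x → Eventually (λ δ → 0# < x + δ * y)
  eventually-pos {x} y 0<x = case compare y 0# of λ where
      (tri< y<0 _ _) → eventually-pos-for-neg y<0 (+-pos 0<1 (inj₁ (x<0⇒0<-x y<0)))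
      (tri≈ _ refl _) → eventually-always λ δ → subst (0# <_) (sym (trans (cong (x +_) (zeroʳ δ)) (+-identityʳ x))) 0<x
      (tri> _ _ 0<y) → 1# , 0<1 , λ δ 0<δ _ → +-pos 0<x (inj₁ (*-pos 0<δ 0<y))
    where
    -- With k = 1 / (1 - y) and ε = x k we have x + δ y = x k + (ε - δ) (- y), which is positive for δ ≤ ε.
    eventually-pos-for-neg : y < 0# → 0# < 1# + - y → Eventually (λ δ → 0# < x + δ * y)
    eventually-pos-for-neg y<0 0<1-y with inverse (1# + - y) (0<x⇒x≢0 0<1-y)
    ... | k , [1-y]k≡1 = x * k , 0<xk , λ δ 0<δ δ≤xk → subst (0# <_) (sym (split δ)) (+-pos 0<xk (slack δ≤xk))
      where
      0<xk : 0# < x * k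
      0<xk = *-pos 0<x (inverse-pos 0<1-y [1-y]k≡1)

      x≡ : x ≡ x * k + (x * k) * (- y)
      x≡ = begin
        x                              ≡⟨ sym (*-identityʳ x) ⟩
        x * 1#                         ≡⟨ cong (x *_) (sym [1-y]k≡1) ⟩
        x * ((1# + - y) * k)           ≡⟨ solve 4 (λ x k m o → x :* ((o :+ m) :* k) := x :* (o :* k) :+ (x :* k) :* m) refl x k (- y) 1# ⟩
        x * (1# * k) + (x * k) * (- y) ≡⟨ cong (λ z → x * z + (x * k) * (- y)) (*-identityˡ k) ⟩
        x * k + (x * k) * (- y)        ∎

      split : ∀ δ → x + δ * y ≡ x * k + (x * k + - δ) * (- y)
      split δ = begin
        x + δ * y                                ≡⟨ cong (_+ δ * y) x≡ ⟩
        (x * k + (x * k) * (- y)) + δ * y        ≡⟨ +-assoc (x * k) _ _ ⟩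
        x * k + ((x * k) * (- y) + δ * y)        ≡⟨ cong (λ z → x * k + ((x * k) * (- y) + z)) (sym -δ*-y≡δ*y) ⟩
        x * k + ((x * k) * (- y) + (- δ) * (- y)) ≡⟨ cong (x * k +_) (sym (distribʳ (- y) (x * k) (- δ))) ⟩
        x * k + (x * k + - δ) * (- y)            ∎
        where
        -δ*-y≡δ*y : (- δ) * (- y) ≡ δ * y
        -δ*-y≡δ*y = trans (-x*y≡x*-y δ (- y)) (cong (δ *_) (-‿involutive y))

      slack : ∀ {δ} → δ ≤ x * k → 0# ≤ (x * k + - δ) * (- y)
      slack (inj₁ δ<xk) = inj₁ (*-pos (<⇒0<-diff δ<xk) (x<0⇒0<-x y<0))
      slack (inj₂ refl) = inj₂ (sym (trans (cong (_* (- y)) (-‿inverseʳ (x * k))) (zeroˡ (- y))))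

  eventually-sgn-stable : ∀ x y → Eventually (λ δ → ¬ x ≡ 0# → sgn (x + δ * y) ≡ sgn x)
  eventually-sgn-stable x y = case compare x 0# of λ where
      (tri< x<0 _ _) → eventually-map (λ 0<-x-δy _ → trans (sgn-neg (0<-x⇒x<0 0<-x-δy)) (sym (sgn-neg x<0)))
                                      (eventually-pos (- y) (x<0⇒0<-x x<0))
      (tri≈ _ x≡0 _) → eventually-always λ _ x≢0 → ⊥-elim (x≢0 x≡0)
      (tri> _ _ 0<x) → eventually-map (λ 0<x+δy _ → trans (sgn-pos 0<x+δy) (sym (sgn-pos 0<x)))
                                      (eventually-pos y 0<x)
    where
    0<-x⇒x<0 : ∀ {δ} → 0# < - x + δ * (- y) → x + δ * y < 0#
    0<-x⇒x<0 {δ} 0<-x-δy = subst (_< 0#) (-‿involutive (x + δ * y)) (0<x⇒-x<0 (subst (0# <_) (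
      trans (cong (- x +_) (sym (-‿distribʳ-* δ y))) (-‿+-comm x (δ * y))) 0<-x-δy))

  sgn-perturbation-pair : ∀ {x ε} y → (¬ x ≡ 0# → sgn (x + ε * y) ≡ sgn x) → (¬ x ≡ 0# → sgn (x + (- ε) * y) ≡ sgn x) →
                          sgn (x + ε * y) ℤ.+ sgn (x + (- ε) * y) ≡ sgn x ℤ.+ sgn x
  sgn-perturbation-pair {x} {ε} y stable₊ stable₋ with x ≟ 0#
  ... | no x≢0 = cong₂ ℤ._+_ (stable₊ x≢0) (stable₋ x≢0)
  ... | yes refl = begin
    sgn (0# + ε * y) ℤ.+ sgn (0# + (- ε) * y)  ≡⟨ cong₂ (λ u w → sgn u ℤ.+ sgn w) (+-identityˡ (ε * y))
                                                   (trans (+-identityˡ ((- ε) * y)) (sym (-‿distribˡ-* ε y))) ⟩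
    sgn (ε * y) ℤ.+ sgn (- (ε * y))           ≡⟨ cong (ℤ._+_ (sgn (ε * y))) (sgn-‿ (ε * y)) ⟩
    sgn (ε * y) ℤ.+ ℤ.- sgn (ε * y)           ≡⟨ ℤ.+-inverseʳ (sgn (ε * y)) ⟩
    0ℤ                                         ≡⟨ cong₂ ℤ._+_ sgn-0 sgn-0 ⟨
    sgn 0# ℤ.+ sgn 0#                          ∎

  perturbation-≢0 : ∀ {x y t} → ¬ t ≡ 0# → (¬ x ≡ 0# → sgn (x + t * y) ≡ sgn x) →
                    ¬ x ≡ 0# ⊎ ¬ y ≡ 0# → ¬ x + t * y ≡ 0#
  perturbation-≢0 _ stable (inj₁ x≢0) = sgn-≡⇒≢0 (stable x≢0) x≢0
  perturbation-≢0 {x} {y} {t} t≢0 stable (inj₂ y≢0) with x ≟ 0#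
  ... | no x≢0 = sgn-≡⇒≢0 (stable x≢0) x≢0
  ... | yes refl = *-≢0 t≢0 y≢0 ∘ trans (sym (+-identityˡ (t * y)))

module LinearAlgebra (R : RealField) where
  open RealField R
  open LinAlg R
  open RealFieldProperties R
  open import Algebra.Properties.Semiring.Sum semiring using (sum; ∑-distrib-+; *-distribˡ-sum; sum-cong-≗)
  open IsStrictTotalOrder isStrictTotalOrder using (_≟_)
  open ≡-Reasoning

  ∑≡sum : ∀ {n} (f : Fin n → Carrier) → ∑ f ≡ sum f
  ∑≡sum {zero} f = refl
  ∑≡sum {suc n} f = cong (f zero +_) (∑≡sum (f ∘ suc))

  ∑-zero : ∀ {n} {f : Fin n → Carrier} → (∀ i → f i ≡ 0#) → ∑ f ≡ 0#
  ∑-zero {zero} _ = refl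
  ∑-zero {suc n} f≡0 = trans (cong₂ _+_ (f≡0 zero) (∑-zero (f≡0 ∘ suc))) (+-identityˡ 0#)

  ∑-linear : ∀ {n} {f g h : Fin n → Carrier} t → (∀ i → f i ≡ g i + t * h i) → ∑ f ≡ ∑ g + t * ∑ h
  ∑-linear {f = f} {g} {h} t f≡ = begin
    ∑ f                         ≡⟨ ∑≡sum f ⟩
    sum f                       ≡⟨ sum-cong-≗ f≡ ⟩
    sum (λ i → g i + t * h i)   ≡⟨ ∑-distrib-+ g (λ i → t * h i) ⟩
    sum g + sum (λ i → t * h i) ≡⟨ cong₂ _+_ (sym (∑≡sum g)) (sym (*-distribˡ-sum t h)) ⟩
    ∑ g + t * sum h             ≡⟨ cong (λ x → ∑ g + t * x) (sym (∑≡sum h)) ⟩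
    ∑ g + t * ∑ h               ∎

  _+[_]_ : ∀ {r} → Vector r → Carrier → Vector r → Vector r
  (u +[ t ] w) j = u j + t * w j

  ev-+[]ˡ : ∀ {r} (a : Vector r) t h v → ev (a +[ t ] h) v ≡ ev a v + t * ev h v
  ev-+[]ˡ a t h v = ∑-linear t λ j →
    solve 4 (λ a t h v → (a :+ t :* h) :* v := a :* v :+ t :* (h :* v)) refl (a j) t (h j) (v j)

  ev-+[]ʳ : ∀ {r} (a : Vector r) v t w → ev a (v +[ t ] w) ≡ ev a v + t * ev a w
  ev-+[]ʳ a v t w = ∑-linear t λ j →
    solve 4 (λ a v t w → a :* (v :+ t :* w) := a :* v :+ t :* (a :* w)) refl (a j) (v j) t (w j)

  unit : ∀ {r} → Fin r → Vector r
  unit zero zero = 1#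
  unit zero (suc _) = 0#
  unit (suc j) zero = 0#
  unit (suc j) (suc k) = unit j k

  ev-unit : ∀ {r} (j : Fin r) v → ev (unit j) v ≡ v j
  ev-unit zero v = trans (cong₂ _+_ (*-identityˡ (v zero)) (∑-zero (zeroˡ ∘ v ∘ suc))) (+-identityʳ (v zero))
  ev-unit (suc j) v = trans (cong₂ _+_ (zeroˡ (v zero)) (ev-unit j (v ∘ suc))) (+-identityˡ (v (suc j)))

  VanishesOn : ∀ {r n} → (Fin n → Vector r) → Subset n → Vector r → Set
  VanishesOn V S h = ∀ i → lookup S i ≡ true → ev h (V i) ≡ 0#

  vanishesOn-+[] : ∀ {r n} {V : Fin n → Vector r} {S a h t} →
                   VanishesOn V S a → VanishesOn V S h → VanishesOn V S (a +[ t ] h)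
  vanishesOn-+[] {V = V} {a = a} {h} {t} a-van h-van i i∈S = begin
    ev (a +[ t ] h) (V i)         ≡⟨ ev-+[]ˡ a t h (V i) ⟩
    ev a (V i) + t * ev h (V i)   ≡⟨ cong₂ (λ x y → x + t * y) (a-van i i∈S) (h-van i i∈S) ⟩
    0# + t * 0#                   ≡⟨ trans (+-identityˡ _) (zeroʳ t) ⟩
    0#                            ∎

  Separates : ∀ {r n} → (Fin n → Vector r) → Subset n → Vector r → Vector r → Set
  Separates V S v h = VanishesOn V S h × ¬ ev h v ≡ 0#

  module _ {r n} (V : Fin (suc n) → Vector r) (S : Subset n) where

    inLin-tail : ∀ b {v} → InLin (V ∘ suc) S v → InLin V (b ∷ S) v
    inLin-tail b (c , v≡) = (λ { zero → 0# ; (suc i) → c i }) , λ j → trans (v≡ j) (sym (head≡0 b j))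
      where
      head≡0 : ∀ b j {s} → (if b then 0# * V zero j else 0#) + s ≡ s
      head≡0 true j = trans (cong (_+ _) (zeroˡ (V zero j))) (+-identityˡ _)
      head≡0 false j = +-identityˡ _

    inLin-cons : ∀ t {v w} → InLin (V ∘ suc) S w → (∀ j → v j ≡ t * V zero j + w j) → InLin V (true ∷ S) v
    inLin-cons t (c , w≡) v≡ = (λ { zero → t ; (suc i) → c i }) , λ j → trans (v≡ j) (cong (t * V zero j +_) (w≡ j))

    separates-skip : ∀ {v h} → Separates (V ∘ suc) S v h → Separates V (false ∷ S) v h
    separates-skip (h-van , hv≢0) = (λ { zero () ; (suc i) → h-van i }) , hv≢0

    separates-cons : ∀ {v h} → Separates (V ∘ suc) S v h → ev h (V zero) ≡ 0# → Separates V (true ∷ S) v h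
    separates-cons (h-van , hv≢0) hV₀≡0 = (λ { zero _ → hV₀≡0 ; (suc i) → h-van i }) , hv≢0

    -- h separates v from the tail but not from V₀ = V zero: separate instead the projection
    -- v' = v - t V₀ of v onto ker h, then correct that separator by a multiple of h to kill V₀.
    project : ∀ v h q⁻¹ → Separates (V ∘ suc) S v h → ev h (V zero) * q⁻¹ ≡ 1# →
      let v' = v +[ - (ev h v * q⁻¹) ] V zero in
      InLin (V ∘ suc) S v' ⊎ ∃ (Separates (V ∘ suc) S v') → InLin V (true ∷ S) v ⊎ ∃ (Separates V (true ∷ S) v)
    project v h q⁻¹ _ _ (inj₁ v'∈) =
      inj₁ (inLin-cons t v'∈ λ j → sym (t*z+[x+-t*z]≡x (v j) t (V zero j)))
      where t = ev h v * q⁻¹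
    project v h q⁻¹ (h-van , _) qq⁻¹≡1 (inj₂ (h' , h'-van , h'v'≢0)) = inj₂ (h' +[ - s ] h , h''-van , h''v≢0)
      where
      s = ev h' (V zero) * q⁻¹
      h''-van : VanishesOn V (true ∷ S) (h' +[ - s ] h)
      h''-van zero _ = trans (ev-+[]ˡ h' (- s) h (V zero)) (x+-[xc]*q≡0 (ev h' (V zero)) qq⁻¹≡1)
      h''-van (suc i) = vanishesOn-+[] {V = V ∘ suc} {S} {h'} {h} h'-van h-van i
      h''v≢0 : ¬ ev (h' +[ - s ] h) v ≡ 0#
      h''v≢0 h''v≡0 = h'v'≢0 (begin
        ev h' (v +[ - (ev h v * q⁻¹) ] V zero)            ≡⟨ ev-+[]ʳ h' v _ (V zero) ⟩
        ev h' v + (- (ev h v * q⁻¹)) * ev h' (V zero)     ≡⟨ cong (ev h' v +_) (-[xc]*y≡-[yc]*x (ev h v) q⁻¹ (ev h' (V zero))) ⟩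
        ev h' v + (- s) * ev h v                          ≡⟨ sym (ev-+[]ˡ h' (- s) h v) ⟩
        ev (h' +[ - s ] h) v                              ≡⟨ h''v≡0 ⟩
        0#                                                ∎)

  inLin⊎separated : ∀ {r n} (V : Fin n → Vector r) S v → InLin V S v ⊎ ∃ (Separates V S v)
  inLin⊎separated {r} {zero} V [] v with all? (λ j → v j ≟ 0#)
  ... | yes v≡0 = inj₁ ((λ ()) , v≡0)
  ... | no v≢0 with ¬∀⟶∃¬ r _ (λ j → v j ≟ 0#) v≢0
  ...   | j , vj≢0 = inj₂ (unit j , (λ ()) , λ e → vj≢0 (trans (sym (ev-unit j v)) e))
  inLin⊎separated {n = suc n} V (b ∷ S) v with inLin⊎separated (V ∘ suc) S v
  ... | inj₁ v∈ = inj₁ (inLin-tail V S b v∈)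
  ... | inj₂ (h , sep) with b | ev h (V zero) ≟ 0#
  ...   | false | _ = inj₂ (h , separates-skip V S sep)
  ...   | true | yes hV₀≡0 = inj₂ (h , separates-cons V S sep hV₀≡0)
  ...   | true | no hV₀≢0 with inverse _ hV₀≢0
  ...     | q⁻¹ , qq⁻¹≡1 = project V S v h q⁻¹ sep qq⁻¹≡1 (inLin⊎separated (V ∘ suc) S _)

x+y≡z+z⇒z≤x⊎z≤y : ∀ {x y z} → x ℤ.+ y ≡ z ℤ.+ z → z ℤ.≤ x ⊎ z ℤ.≤ y
x+y≡z+z⇒z≤x⊎z≤y {x} {y} {z} x+y≡z+z with z ℤ.≤? x | z ℤ.≤? y
... | yes z≤x | _ = inj₁ z≤x
... | no _ | yes z≤y = inj₂ z≤y
... | no z≰x | no z≰y = ⊥-elim (ℤ.<-irrefl x+y≡z+z (ℤ.+-mono-< (ℤ.≰⇒> z≰x) (ℤ.≰⇒> z≰y)))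

module Scores (R : RealField) where
  open LinAlg R
  open RealFieldProperties R using (sgn; bit)
  open import Algebra.Properties.CommutativeMonoid.Sum ℤ.+-0-commutativeMonoid public
    using () renaming (sum to ∑ℤ; ∑-distrib-+ to ∑ℤ-distrib-+; sum-cong-≗ to ∑ℤ-cong)
  open ≡-Reasoning

  count-difference : ∀ {n} (p q : Fin n → Bool) →
    ℤ.+ count p ℤ.- ℤ.+ count q ≡ ∑ℤ (λ i → ℤ.+ bit (p i) ℤ.- ℤ.+ bit (q i))
  count-difference {zero} p q = refl
  count-difference {suc n} p q = begin
    ℤ.+ (bit p₀ ℕ.+ count (p ∘ suc)) ℤ.- ℤ.+ (bit q₀ ℕ.+ count (q ∘ suc))
      ≡⟨ cong₂ ℤ._-_ (ℤ.pos-+ (bit p₀) _) (ℤ.pos-+ (bit q₀) _) ⟩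
    (ℤ.+ bit p₀ ℤ.+ ℤ.+ count (p ∘ suc)) ℤ.- (ℤ.+ bit q₀ ℤ.+ ℤ.+ count (q ∘ suc))
      ≡⟨ regroup (ℤ.+ bit p₀) (ℤ.+ bit q₀) (ℤ.+ count (p ∘ suc)) (ℤ.+ count (q ∘ suc)) ⟩
    (ℤ.+ bit p₀ ℤ.- ℤ.+ bit q₀) ℤ.+ (ℤ.+ count (p ∘ suc) ℤ.- ℤ.+ count (q ∘ suc))
      ≡⟨ cong (ℤ._+_ (ℤ.+ bit p₀ ℤ.- ℤ.+ bit q₀)) (count-difference (p ∘ suc) (q ∘ suc)) ⟩
    ∑ℤ (λ i → ℤ.+ bit (p i) ℤ.- ℤ.+ bit (q i))  ∎
    where
    p₀ = p zero
    q₀ = q zero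
    regroup : ∀ a b c d → (a ℤ.+ c) ℤ.- (b ℤ.+ d) ≡ (a ℤ.- b) ℤ.+ (c ℤ.- d)
    regroup = solve-∀

  signAt : ∀ {r n} → (Fin n → Vector r) → Subset n → Vector r → Fin n → ℤ
  signAt V M a i = if lookup M i then sgn (ev a (V i)) else 0ℤ

  score≡∑signAt : ∀ {r n} (V : Fin n → Vector r) M a → score V M a ≡ ∑ℤ (signAt V M a)
  score≡∑signAt {n = n} V M a =
    trans (count-difference {n} _ _) (∑ℤ-cong {n} λ i → masked (lookup M i))
    where
    masked : ∀ m {p q} → ℤ.+ bit (m ∧ p) ℤ.- ℤ.+ bit (m ∧ q) ≡ (if m then ℤ.+ bit p ℤ.- ℤ.+ bit q else 0ℤ)
    masked true = refl
    masked false = refl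

module Configuration (R : RealField) {r n} (V : Fin n → LinAlg.Vector R r) where
  open RealField R
  open LinAlg R
  open RealFieldProperties R
  open LinearAlgebra R
  open Scores R
  open ≡-Reasoning

  -- Opaque so that the typechecker never unfolds the choice between a + ε h and a - ε h,
  -- which would make it evaluate scores.
  opaque
    score-nondecreasing-perturbation : ∀ M (a h : Vector r) → ∃ λ t →
      score V M a ℤ.≤ score V M (a +[ t ] h) ×
      (∀ j → ¬ ev a (V j) ≡ 0# ⊎ ¬ ev h (V j) ≡ 0# → ¬ ev (a +[ t ] h) (V j) ≡ 0#)
    score-nondecreasing-perturbation M a h
      with eventually⇒∃ (eventually-× (eventually-∀ λ j → eventually-sgn-stable (ev a (V j)) (ev h (V j)))
                                      (eventually-∀ λ j → eventually-sgn-stable (ev a (V j)) (- ev h (V j))))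
    ... | ε , 0<ε , stable₊ , stable₋ = case x+y≡z+z⇒z≤x⊎z≤y score-pair of λ where
          (inj₁ a≤a₊) → ε , a≤a₊ , support ε (0<x⇒x≢0 0<ε) stable₊
          (inj₂ a≤a₋) → - ε , a≤a₋ , support (- ε) (x<0⇒x≢0 (0<x⇒-x<0 0<ε)) stable₋'
      where
      x y : Fin n → Carrier
      x j = ev a (V j)
      y j = ev h (V j)

      stable₋' : ∀ j → ¬ x j ≡ 0# → sgn (x j + (- ε) * y j) ≡ sgn (x j)
      stable₋' j = trans (cong (λ w → sgn (x j + w)) (-x*y≡x*-y ε (y j))) ∘ stable₋ j

      support : ∀ t → ¬ t ≡ 0# → (∀ j → ¬ x j ≡ 0# → sgn (x j + t * y j) ≡ sgn (x j)) →
                ∀ j → ¬ x j ≡ 0# ⊎ ¬ y j ≡ 0# → ¬ ev (a +[ t ] h) (V j) ≡ 0#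
      support t t≢0 stable j x≢0⊎y≢0 = perturbation-≢0 t≢0 (stable j) x≢0⊎y≢0 ∘ trans (sym (ev-+[]ˡ a t h (V j)))

      masked-pair : ∀ m {u v w} → u ℤ.+ v ≡ w ℤ.+ w →
        (if m then u else 0ℤ) ℤ.+ (if m then v else 0ℤ) ≡ (if m then w else 0ℤ) ℤ.+ (if m then w else 0ℤ)
      masked-pair true u+v≡w+w = u+v≡w+w
      masked-pair false _ = refl

      s s₊ s₋ : Fin n → ℤ
      s = signAt V M a
      s₊ = signAt V M (a +[ ε ] h)
      s₋ = signAt V M (a +[ - ε ] h)

      pair : ∀ j → s₊ j ℤ.+ s₋ j ≡ s j ℤ.+ s j
      pair j = masked-pair (lookup M j) (begin
        sgn (ev (a +[ ε ] h) (V j)) ℤ.+ sgn (ev (a +[ - ε ] h) (V j))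
          ≡⟨ cong₂ (λ u w → sgn u ℤ.+ sgn w) (ev-+[]ˡ a ε h (V j)) (ev-+[]ˡ a (- ε) h (V j)) ⟩
        sgn (x j + ε * y j) ℤ.+ sgn (x j + (- ε) * y j)
          ≡⟨ sgn-perturbation-pair (y j) (stable₊ j) (stable₋' j) ⟩
        sgn (x j) ℤ.+ sgn (x j)  ∎)

      score-pair : score V M (a +[ ε ] h) ℤ.+ score V M (a +[ - ε ] h) ≡ score V M a ℤ.+ score V M a
      score-pair = begin
        score V M (a +[ ε ] h) ℤ.+ score V M (a +[ - ε ] h)
          ≡⟨ cong₂ ℤ._+_ (score≡∑signAt V M _) (score≡∑signAt V M _) ⟩
        ∑ℤ s₊ ℤ.+ ∑ℤ s₋                ≡⟨ ∑ℤ-distrib-+ s₊ s₋ ⟨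
        ∑ℤ (λ j → s₊ j ℤ.+ s₋ j)       ≡⟨ ∑ℤ-cong {n} pair ⟩
        ∑ℤ (λ j → s j ℤ.+ s j)         ≡⟨ ∑ℤ-distrib-+ s s ⟩
        ∑ℤ s ℤ.+ ∑ℤ s                  ≡⟨ cong₂ ℤ._+_ (score≡∑signAt V M a) (score≡∑signAt V M a) ⟨
        score V M a ℤ.+ score V M a    ∎

  module _ (S : Subset n) (separable : ∀ i → lookup S i ≡ false → ∃ (Separates V S (V i))) where

    NonzeroOffOn : Vector r → List (Fin n) → Set
    NonzeroOffOn a = All (λ i → lookup S i ≡ false → ¬ ev a (V i) ≡ 0#)

    extension-step : ∀ {i} a → VanishesOn V S a → lookup S i ≡ false → ∃ λ a' → VanishesOn V S a' ×
      score V (∁ S) a ℤ.≤ score V (∁ S) a' × (∀ j → ¬ ev a (V j) ≡ 0# → ¬ ev a' (V j) ≡ 0#) × ¬ ev a' (V i) ≡ 0#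
    extension-step {i} a a-van S[i] =
      let (h , h-van , hVi≢0) = separable i S[i]
          (t , a≤a' , a'-nz) = score-nondecreasing-perturbation (∁ S) a h
      in a +[ t ] h , vanishesOn-+[] {V = V} {S} {a} {h} a-van h-van , a≤a' , (λ j → a'-nz j ∘ inj₁) ,
         a'-nz i (inj₂ hVi≢0)

    Extension : Vector r → List (Fin n) → Set
    Extension a L = ∃ λ a' → VanishesOn V S a' × score V (∁ S) a ℤ.≤ score V (∁ S) a' × NonzeroOffOn a' L

    extension-cons : ∀ {a L} i → Dec (lookup S i ≡ false) → Extension a L → Extension a (i ∷ L)
    extension-cons i (no S[i]≢false) (a₁ , a₁-van , a≤a₁ , a₁-nz) =
      a₁ , a₁-van , a≤a₁ , (λ S[i] → contradiction S[i] S[i]≢false) ∷ a₁-nz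
    extension-cons i (yes S[i]) (a₁ , a₁-van , a≤a₁ , a₁-nz) =
      let (a₂ , a₂-van , a₁≤a₂ , a₁⇒a₂ , a₂Vi≢0) = extension-step a₁ a₁-van S[i]
      in a₂ , a₂-van , ℤ.≤-trans a≤a₁ a₁≤a₂ , (λ _ → a₂Vi≢0) ∷ All.map (λ a₁-nz-j S[j] → a₁⇒a₂ _ (a₁-nz-j S[j])) a₁-nz

    support-extension : ∀ L a → VanishesOn V S a → Extension a L
    support-extension [] a a-van = a , a-van , ℤ.≤-refl , []
    support-extension (i ∷ L) a a-van = extension-cons i (lookup S i Bool.≟ false) (support-extension L a a-van)

    nonzero-off-extension : ∀ a → VanishesOn V S a → ∃ λ a' → VanishesOn V S a' ×
      score V (∁ S) a ℤ.≤ score V (∁ S) a' × (∀ i → lookup S i ≡ false → ¬ ev a' (V i) ≡ 0#)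
    nonzero-off-extension a a-van with support-extension (allFin n) a a-van
    ... | a' , a'-van , a≤a' , a'-nz = a' , a'-van , a≤a' , λ i → All.lookup a'-nz (∈-allFin i)

  score-split : ∀ S a b → VanishesOn V S a → (∀ i → lookup S i ≡ false → ¬ ev a (V i) ≡ 0#) →
    ∃ λ f → score V ⊤ f ≡ score V S b ℤ.+ score V (∁ S) a
  score-split S a b a-van a-nz
    with eventually⇒∃ (eventually-∀ λ i → eventually-sgn-stable (ev a (V i)) (ev b (V i)))
  ... | δ , 0<δ , stable = a +[ δ ] b , (begin
    score V ⊤ (a +[ δ ] b)                              ≡⟨ score≡∑signAt V ⊤ _ ⟩
    ∑ℤ (signAt V ⊤ (a +[ δ ] b))                        ≡⟨ ∑ℤ-cong {n} split ⟩
    ∑ℤ (λ i → signAt V S b i ℤ.+ signAt V (∁ S) a i)   ≡⟨ ∑ℤ-distrib-+ (signAt V S b) (signAt V (∁ S) a) ⟩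
    ∑ℤ (signAt V S b) ℤ.+ ∑ℤ (signAt V (∁ S) a)        ≡⟨ cong₂ ℤ._+_ (score≡∑signAt V S b) (score≡∑signAt V (∁ S) a) ⟨
    score V S b ℤ.+ score V (∁ S) a                     ∎)
    where
    by-membership : ∀ i m → lookup S i ≡ m → sgn (ev (a +[ δ ] b) (V i)) ≡
      (if m then sgn (ev b (V i)) else 0ℤ) ℤ.+ (if not m then sgn (ev a (V i)) else 0ℤ)
    by-membership i true S[i] = begin
      sgn (ev (a +[ δ ] b) (V i))          ≡⟨ cong sgn (ev-+[]ˡ a δ b (V i)) ⟩
      sgn (ev a (V i) + δ * ev b (V i))    ≡⟨ cong (λ x → sgn (x + δ * ev b (V i))) (a-van i S[i]) ⟩
      sgn (0# + δ * ev b (V i))            ≡⟨ cong sgn (+-identityˡ _) ⟩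
      sgn (δ * ev b (V i))                 ≡⟨ sgn-*-pos (ev b (V i)) 0<δ ⟩
      sgn (ev b (V i))                     ≡⟨ ℤ.+-identityʳ _ ⟨
      sgn (ev b (V i)) ℤ.+ 0ℤ              ∎
    by-membership i false S[i] =
      trans (cong sgn (ev-+[]ˡ a δ b (V i))) (trans (stable i (a-nz i S[i])) (sym (ℤ.+-identityˡ _)))

    split : ∀ i → signAt V ⊤ (a +[ δ ] b) i ≡ signAt V S b i ℤ.+ signAt V (∁ S) a i
    split i = begin
      signAt V ⊤ (a +[ δ ] b) i
        ≡⟨ cong (λ m → if m then sgn (ev (a +[ δ ] b) (V i)) else 0ℤ) (lookup-replicate i true) ⟩
      sgn (ev (a +[ δ ] b) (V i))
        ≡⟨ by-membership i (lookup S i) refl ⟩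
      signAt V S b i ℤ.+ (if not (lookup S i) then sgn (ev a (V i)) else 0ℤ)
        ≡⟨ cong (λ m → signAt V S b i ℤ.+ (if m then sgn (ev a (V i)) else 0ℤ)) (lookup-map i not S) ⟨
      signAt V S b i ℤ.+ signAt V (∁ S) a i  ∎

  separable : ∀ S → (∀ i → InLin V S (V i) → lookup S i ≡ true) →
              ∀ i → lookup S i ≡ false → ∃ (Separates V S (V i))
  separable S closed i S[i] with inLin⊎separated V S (V i)
  ... | inj₁ Vi∈linW = case trans (sym (closed i Vi∈linW)) S[i] of λ ()
  ... | inj₂ separated = separated

open import Data.Integer using (_+_; _≤_)

mainTheorem11 : (R : RealField) → (r n : ℕ) →
    (V : Fin n → LinAlg.Vector R r) → (S : Subset n) →
    (∀ i → LinAlg.InLin R V S (V i) → lookup S i ≡ true) →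
    (dV dW dQ : ℤ) →
    LinAlg.IsDisc R V ⊤ dV → LinAlg.IsDisc R V S dW → LinAlg.IsDiscQuot R V S dQ →
    dW + dQ ≤ dV
mainTheorem11 R r n V S closed dV dW dQ (_ , score≤dV) ((b , _ , b≡dW) , _) ((a , a-van , a≡dQ) , _) =
  let (a' , a'-van , a≤a' , a'-nz) = nonzero-off-extension S (separable S closed) a a-van
      (f , f≡) = score-split S a' b a'-van a'-nz
  in begin
    dW + dQ                          ≡⟨ cong₂ _+_ b≡dW a≡dQ ⟨
    score V S b + score V (∁ S) a    ≤⟨ ℤ.+-monoʳ-≤ (score V S b) a≤a' ⟩
    score V S b + score V (∁ S) a'   ≡⟨ f≡ ⟨
    score V ⊤ f                      ≤⟨ score≤dV f _ ⟩
    dV                               ∎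
  where
  open LinAlg R using (score)
  open Configuration R V
  open ℤ.≤-Reasoning
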